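{- Let $R$ be any one of the following ten subsets of $\{0,1,2,3\}^2$, each described as $\{0,1,2,3\}^2$ minus the listed boxes: (S9) minus $\{(3,3)\}$; (S10) minus $\{(0,0)\}$; (S11) minus $\{(2,2)\}$; (S12) minus $\{(1,1)\}$; (S13) minus $\{(1,2),(2,1)\}$; (S14) minus $\{(1,1),(2,2)\}$; (S15) minus $\{(1,2),(2,1),(2,2)\}$; (S16) minus $\{(1,1),(1,2),(2,1)\}$; (S17) minus $\{(1,2),(2,1),(3,3)\}$; (S18) minus $\{(0,0),(1,2),(2,1)\}$. Then the mesh patterns $(123,R)$ and $(321,R)$ are jointly equidistributed.
   Context: $S_n$ is the set of permutations of $\{1,\dots,n\}$. A mesh pattern of length $k$ is a pair $(\tau,R)$ with $\tau\in S_k$ and $R\subseteq\{0,\dots,k\}^2$; the element $(a,b)\in R$ is the "shaded box" whose corners are $(a,b),(a,b+1),(a+1,b+1),(a+1,b)$ in the plot of $\tau$ (first coordinate = position, second = value). An occurrence of $(\tau,R)$ in $\pi=\pi_1\cdots\pi_n\in S_n$ is a tuple of indices $i_1<\dots<i_k$ such that $\pi_{i_1}\cdots\pi_{i_k}$ is order-isomorphic to $\tau$ and, setting $i_0=0$, $i_{k+1}=n+1$, letting $v_1<\dots<v_k$ be the values $\pi_{i_1},\dots,\pi_{i_k}$ in increasing order and $v_0=0$, $v_{k+1}=n+1$, for every $(a,b)\in R$ there is no index $m$ with $i_a<m<i_{a+1}$ and $v_b<\pi_m<v_{b+1}$. The number of occurrences is the number of such index tuples. Two mesh patterns $q_1,q_2$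 are jointly equidistributed if for all $n\ge 1$ and all integers $k,\ell\ge 0$, the number of $\pi\in S_n$ with exactly $k$ occurrences of $q_1$ and exactly $\ell$ occurrences of $q_2$ equals the number of $\pi\in S_n$ with exactly $\ell$ occurrences of $q_1$ and exactly $k$ occurrences of $q_2$. -}

module Defs where

open import Data.Nat using (ℕ; zero; suc; _+_; _≤_; _<ᵇ_; _≡ᵇ_; _≤ᵇ_)
open import Data.Bool using (Bool; true; false; _∧_; not; if_then_else_)
open import Data.List using (List; []; _∷_; _++_; [_]; map; filter; length; concatMap; upTo; applyUpTo)
open import Data.Bool.ListAction using (all; any)
open import Data.Product using (_×_; _,_)
open import Relation.Binary.PropositionalEquality using (_≡_)
open import Relation.Nullary.Decidable using (Dec; yes; no)
open import Data.Bool using (T)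
open import Data.Bool.Properties using (T?)

-- Conventions: all positions and values are 1-based natural numbers, exactly
-- as in the paper.  A permutation π ∈ S_n is the list π₁ ⋯ πₙ.

-- 0-based list lookup with default 0
at : List ℕ → ℕ → ℕ
at []       _       = 0
at (x ∷ xs) zero    = x
at (x ∷ xs) (suc i) = at xs i

oneTo : ℕ → List ℕ
oneTo n = applyUpTo suc n

elemᵇ : ℕ → List ℕ → Bool
elemᵇ x xs = any (λ y → x ≡ᵇ y) xs

insert : ℕ → List ℕ → List ℕ
insert x []       = x ∷ []
insert x (y ∷ ys) = if x ≤ᵇ y then x ∷ y ∷ ys else y ∷ insert x ys

isort : List ℕ → List ℕ
isort []       = []
isort (x ∷ xs) = insert x (isort xs)

words : ℕ → List ℕ → List (List ℕ)
words zero    xs = [] ∷ []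
words (suc k) xs = concatMap (λ x → map (x ∷_) (words k xs)) xs

-- a word of length n over {1,…,n} is a permutation iff every value occurs
isPermᵇ : ℕ → List ℕ → Bool
isPermᵇ n π = all (λ v → elemᵇ v π) (oneTo n)

S : ℕ → List (List ℕ)
S n = filter (λ π → T? (isPermᵇ n π)) (words n (oneTo n))

record MeshPattern : Set where
  constructor mesh
  field
    len    : ℕ
    τ      : List ℕ
    shaded : List (ℕ × ℕ)    -- R ⊆ {0,…,len}², box (a,b)

open MeshPattern public

choose : ℕ → List ℕ → List (List ℕ)
choose zero    _        = [] ∷ []
choose (suc k) []       = []
choose (suc k) (x ∷ xs) = map (x ∷_) (choose k xs) ++ choose (suc k) xs

-- π_{i} for a 1-based position i
val : List ℕ → ℕ → ℕ
val π i = at π (i ∸1)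
  where
  _∸1 : ℕ → ℕ
  zero ∸1  = zero
  suc m ∸1 = m

orderIsoᵇ : ℕ → List ℕ → List ℕ → Bool
orderIsoᵇ k w τ' =
  all (λ a → all (λ b → eqB (at w a <ᵇ at w b) (at τ' a <ᵇ at τ' b)) (upTo k)) (upTo k)
  where
  eqB : Bool → Bool → Bool
  eqB true  y = y
  eqB false y = not y

isOccᵇ : ℕ → MeshPattern → List ℕ → List ℕ → Bool
isOccᵇ n q π is =
  orderIsoᵇ (len q) w (τ q) ∧ all boxEmpty (shaded q)
  where
  w  = map (val π) is
  iE = 0 ∷ is ++ [ suc n ]            -- i₀ = 0, i₁ … i_k, i_{k+1} = n+1
  vE = 0 ∷ isort w ++ [ suc n ]       -- v₀ = 0, v₁ < ⋯ < v_k, v_{k+1} = n+1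
  boxEmpty : ℕ × ℕ → Bool
  boxEmpty (a , b) =
    not (any (λ m → (at iE a <ᵇ m) ∧ (m <ᵇ at iE (suc a))
                  ∧ (at vE b <ᵇ val π m) ∧ (val π m <ᵇ at vE (suc b)))
             (oneTo n))

occ : ℕ → MeshPattern → List ℕ → ℕ
occ n q π = length (filter (λ is → T? (isOccᵇ n q π is)) (choose (len q) (oneTo n)))

jointCount : ℕ → MeshPattern → MeshPattern → ℕ → ℕ → ℕ
jointCount n q₁ q₂ k ℓ =
  length (filter (λ π → T? ((occ n q₁ π ≡ᵇ k) ∧ (occ n q₂ π ≡ᵇ ℓ))) (S n))

JointlyEquidistributed : MeshPattern → MeshPattern → Set
JointlyEquidistributed q₁ q₂ =
  (n : ℕ) → 1 ≤ n → (k ℓ : ℕ) → jointCount n q₁ q₂ k ℓ ≡ jointCount n q₁ q₂ ℓ k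

grid4 : List (ℕ × ℕ)
grid4 = concatMap (λ a → map (a ,_) (upTo 4)) (upTo 4)

pairEqᵇ : ℕ × ℕ → ℕ × ℕ → Bool
pairEqᵇ (a , b) (c , d) = (a ≡ᵇ c) ∧ (b ≡ᵇ d)

gridMinus : List (ℕ × ℕ) → List (ℕ × ℕ)
gridMinus xs = filter (λ p → T? (not (any (pairEqᵇ p) xs))) grid4

data Case : Set where
  S9 S10 S11 S12 S13 S14 S15 S16 S17 S18 : Case

shading : Case → List (ℕ × ℕ)
shading S9  = gridMinus ((3 , 3) ∷ [])
shading S10 = gridMinus ((0 , 0) ∷ [])
shading S11 = gridMinus ((2 , 2) ∷ [])
shading S12 = gridMinus ((1 , 1) ∷ [])
shading S13 = gridMinus ((1 , 2) ∷ (2 , 1) ∷ [])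
shading S14 = gridMinus ((1 , 1) ∷ (2 , 2) ∷ [])
shading S15 = gridMinus ((1 , 2) ∷ (2 , 1) ∷ (2 , 2) ∷ [])
shading S16 = gridMinus ((1 , 1) ∷ (1 , 2) ∷ (2 , 1) ∷ [])
shading S17 = gridMinus ((1 , 2) ∷ (2 , 1) ∷ (3 , 3) ∷ [])
shading S18 = gridMinus ((0 , 0) ∷ (1 , 2) ∷ (2 , 1) ∷ [])

p123 : Case → MeshPattern
p123 c = mesh 3 (1 ∷ 2 ∷ 3 ∷ []) (shading c)

p321 : Case → MeshPattern
p321 c = mesh 3 (3 ∷ 2 ∷ 1 ∷ []) (shading c)

{-# OPTIONS --safe #-}
-- In each of the ten cases all occurrences of (123, R) and of (321, R) in a permutation π share
-- their first and last positions i < k. For S11-S16 this is because the outer columns of R are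
-- entirely shaded, which forces i = 1 and k = n; for S9 and S10 three columns are entirely shaded;
-- for S17 and S18 one outer column is, and the other end is pinned down by placing the points of
-- one occurrence in the unshaded boxes of another. Exchanging the entries π i and π k turns every
-- occurrence of one pattern at positions (i, j, k) into an occurrence of the other at the same
-- positions and vice versa, since it changes neither the set of values nor any other point.
-- Performing this exchange at the ends of the occurrences, and nothing if there are none, is
-- therefore an involution of S n that swaps the numbers of occurrences of the two patterns.

module Submission where

open import Defs

open import Data.Bool using (Bool; true; false; _∧_; _∨_; not; T)
open import Data.Bool.ListAction using (and; or; all; any)
open import Data.Bool.Properties using (T?; T-≡; T-not-≡; T-∧; T-∨; ∧-comm)
open import Data.Empty using (⊥; ⊥-elim)
open import Data.List
  using (List; []; _∷_; _++_; map; head; upTo; filter; length; concatMap; applyUpTo; cartesianProductWith)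
open import Data.List.Properties using (length-++; length-map; length-applyUpTo; map-cong; map-cong-local)
open import Data.List.Membership.Propositional using (_∈_; _∉_; find; lose)
open import Data.List.Membership.Propositional.Properties
  using (∈-map⁺; ∈-map⁻; ∈-∃++; ∈-++⁻; ∈-++⁺ˡ; ∈-++⁺ʳ; ∈-applyUpTo⁺; ∈-applyUpTo⁻;
         ∈-concatMap⁺; ∈-concatMap⁻; ∈-filter⁺; ∈-filter⁻; ∈-upTo⁺)
open import Data.List.Membership.Propositional.Properties.WithK using (unique∧set⇒bag)
open import Data.List.Relation.Binary.BagAndSetEquality using (∼bag⇒↭)
open import Data.List.Relation.Binary.Permutation.Propositional using (↭-sym)
open import Data.List.Relation.Binary.Permutation.Propositional.Properties using (↭-length; filter-↭)
open import Data.List.Relation.Binary.Sublist.Propositional using (_⊆_; []; _∷_; _∷ʳ_; minimum; lookup)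
open import Data.List.Relation.Binary.Sublist.Propositional.Properties using (All-resp-⊆)
open import Data.List.Relation.Unary.All as All using (All; []; _∷_)
import Data.List.Relation.Unary.All.Properties as All
open import Data.List.Relation.Unary.AllPairs as AllPairs using (AllPairs; []; _∷_)
import Data.List.Relation.Unary.AllPairs.Properties as AllPairs
open import Data.List.Relation.Unary.Any as Any using (here; there)
import Data.List.Relation.Unary.Any.Properties as Any
open import Data.List.Relation.Unary.Unique.Propositional using (Unique)
import Data.List.Relation.Unary.Unique.Propositional.Properties as Unique
open import Data.Maybe using (Maybe; just; nothing)
open import Data.Nat using (ℕ; zero; suc; _+_; _∸_; _≤_; _<_; z≤n; s≤s; _≟_; _≡ᵇ_; _<ᵇ_; _≤ᵇ_)
open import Data.Nat.Properties
open import Data.Product using (_×_; _,_; proj₁; proj₂; ∃-syntax)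
open import Data.Product.Properties using (≡-dec)
open import Data.List.Membership.DecPropositional (≡-dec _≟_ _≟_) using (_∈?_)
open import Data.Sum as Sum using (_⊎_; inj₁; inj₂)
open import Function using (_∘_; _⇔_; mk⇔; Equivalence)
open import Relation.Binary.Definitions using (tri<; tri≈; tri>)
open import Relation.Binary.PropositionalEquality
  using (_≡_; _≢_; refl; sym; trans; cong; cong₂; subst; module ≡-Reasoning)
open import Relation.Nullary using (¬_; yes; no)

-- Counting along an involution

module _ {A : Set} where

  length-filter-map : ∀ (p : A → Bool) (φ : A → A) xs →
    length (filter (T? ∘ p) (map φ xs)) ≡ length (filter (T? ∘ (p ∘ φ)) xs)
  length-filter-map p φ []       = refl
  length-filter-map p φ (x ∷ xs) with p (φ x)
  ... | true  = cong suc (length-filter-map p φ xs)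
  ... | false = length-filter-map p φ xs

  length-filter-cong : ∀ {p q : A → Bool} xs → (∀ {x} → x ∈ xs → p x ≡ q x) →
    length (filter (T? ∘ p) xs) ≡ length (filter (T? ∘ q) xs)
  length-filter-cong []       _  = refl
  length-filter-cong {p} {q} (x ∷ xs) eq with p x | q x | eq (here refl)
  ... | true  | true  | refl = cong suc (length-filter-cong xs (eq ∘ there))
  ... | false | false | refl = length-filter-cong xs (eq ∘ there)

  map-unique : ∀ {φ : A → A} {xs} → (∀ {x y} → x ∈ xs → y ∈ xs → φ x ≡ φ y → x ≡ y) →
    Unique xs → Unique (map φ xs)
  map-unique inj []           = []
  map-unique inj (x∉xs ∷ u) =
    All.map⁺ (All.tabulate λ y∈xs e → All.lookup x∉xs y∈xs (inj (here refl) (there y∈xs) e))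
    ∷ map-unique (λ x∈ y∈ → inj (there x∈) (there y∈)) u

  length-filter-involution : ∀ (p q : A → Bool) (φ : A → A) {xs} → Unique xs →
    (∀ {x} → x ∈ xs → φ x ∈ xs) → (∀ {x} → x ∈ xs → φ (φ x) ≡ x) →
    (∀ {x} → x ∈ xs → p (φ x) ≡ q x) →
    length (filter (T? ∘ p) xs) ≡ length (filter (T? ∘ q) xs)
  length-filter-involution p q φ {xs} u closed invol eq = begin
    length (filter (T? ∘ p) xs)          ≡⟨ ↭-length (filter-↭ (T? ∘ p) (↭-sym φxs↭xs)) ⟩
    length (filter (T? ∘ p) (map φ xs))  ≡⟨ length-filter-map p φ xs ⟩
    length (filter (T? ∘ (p ∘ φ)) xs)    ≡⟨ length-filter-cong xs eq ⟩
    length (filter (T? ∘ q) xs)          ∎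
    where
    open ≡-Reasoning
    injective : ∀ {x y} → x ∈ xs → y ∈ xs → φ x ≡ φ y → x ≡ y
    injective x∈ y∈ e = trans (sym (invol x∈)) (trans (cong φ e) (invol y∈))
    same-elements : ∀ {z} → z ∈ map φ xs ⇔ z ∈ xs
    same-elements = mk⇔
      (λ z∈ → let (x , x∈ , z≡φx) = ∈-map⁻ φ z∈ in subst (_∈ xs) (sym z≡φx) (closed x∈))
      (λ z∈ → subst (_∈ map φ xs) (invol z∈) (∈-map⁺ φ (closed z∈)))
    φxs↭xs = ∼bag⇒↭ (unique∧set⇒bag (map-unique injective u) u same-elements)

  unique⊆⇒length≤ : ∀ {xs ys : List A} → Unique xs → (∀ {x} → x ∈ xs → x ∈ ys) →
    length xs ≤ length ys
  unique⊆⇒length≤ {[]}     _            _   = z≤n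
  unique⊆⇒length≤ {x ∷ xs} (x∉xs ∷ u) sub with ∈-∃++ (sub (here refl))
  ... | as , bs , refl = begin
    suc (length xs)            ≤⟨ s≤s (unique⊆⇒length≤ u sub′) ⟩
    suc (length (as ++ bs))    ≡⟨ cong suc (length-++ as) ⟩
    suc (length as + length bs) ≡⟨ sym (+-suc (length as) (length bs)) ⟩
    length as + length (x ∷ bs) ≡⟨ sym (length-++ as) ⟩
    length (as ++ x ∷ bs)      ∎
    where
    open ≤-Reasoning
    sub′ : ∀ {y} → y ∈ xs → y ∈ as ++ bs
    sub′ {y} y∈ with ∈-++⁻ as (sub (there y∈))
    ... | inj₁ y∈as = ∈-++⁺ˡ y∈as
    ... | inj₂ (here refl) = ⊥-elim (All.lookup x∉xs y∈ refl)
    ... | inj₂ (there y∈bs) = ∈-++⁺ʳ as y∈bs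

  AllPairs-resp-⊇ : ∀ {R : A → A → Set} {xs ys : List A} → xs ⊆ ys → AllPairs R ys → AllPairs R xs
  AllPairs-resp-⊇ []          []         = []
  AllPairs-resp-⊇ (y ∷ʳ xs⊆) (_ ∷ Rys)  = AllPairs-resp-⊇ xs⊆ Rys
  AllPairs-resp-⊇ (refl ∷ xs⊆) (Ry ∷ Rys) = All-resp-⊆ xs⊆ Ry ∷ AllPairs-resp-⊇ xs⊆ Rys

-- Positions, triples and permutations

_∈[1,_] : ℕ → ℕ → Set
m ∈[1, n ] = 1 ≤ m × m ≤ n

∈oneTo⁻ : ∀ {n m} → m ∈ oneTo n → m ∈[1, n ]
∈oneTo⁻ m∈ with ∈-applyUpTo⁻ suc m∈
... | _ , i<n , refl = s≤s z≤n , i<n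

∈oneTo⁺ : ∀ {n m} → m ∈[1, n ] → m ∈ oneTo n
∈oneTo⁺ {m = suc m} (_ , m<n) = ∈-applyUpTo⁺ suc m<n

oneTo-ascending : ∀ n → AllPairs _<_ (oneTo n)
oneTo-ascending n = AllPairs.applyUpTo⁺₁ suc n (λ i<j _ → s≤s i<j)

oneTo-unique : ∀ n → Unique (oneTo n)
oneTo-unique n = AllPairs.map (λ m<m′ → <⇒≢ m<m′) (oneTo-ascending n)

choose-⊆ : ∀ k xs {t} → t ∈ choose k xs → t ⊆ xs
choose-⊆ zero    xs       (here refl) = minimum xs
choose-⊆ (suc k) (x ∷ xs) t∈ with ∈-++⁻ (map (x ∷_) (choose k xs)) t∈
... | inj₁ t∈₁ with ∈-map⁻ (x ∷_) t∈₁
...   | t′ , t′∈ , refl = refl ∷ choose-⊆ k xs t′∈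
choose-⊆ (suc k) (x ∷ xs) t∈ | inj₂ t∈₂ = x ∷ʳ choose-⊆ (suc k) xs t∈₂

choose-length : ∀ k xs {t} → t ∈ choose k xs → length t ≡ k
choose-length zero    xs       (here refl) = refl
choose-length (suc k) (x ∷ xs) t∈ with ∈-++⁻ (map (x ∷_) (choose k xs)) t∈
... | inj₁ t∈₁ with ∈-map⁻ (x ∷_) t∈₁
...   | t′ , t′∈ , refl = cong suc (choose-length k xs t′∈)
choose-length (suc k) (x ∷ xs) t∈ | inj₂ t∈₂ = choose-length (suc k) xs t∈₂

pattern [_,_,_] x y z = x ∷ y ∷ z ∷ []

record Ascending (n i j k : ℕ) : Set where
  field
    1≤i : 1 ≤ i
    i<j : i < j
    j<k : j < k
    k≤n : k ≤ n

  i<k : i < k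
  i<k = <-trans i<j j<k

  i∈ : i ∈[1, n ]
  i∈ = 1≤i , <⇒≤ (<-≤-trans i<k k≤n)

  j∈ : j ∈[1, n ]
  j∈ = ≤-trans 1≤i (<⇒≤ i<j) , <⇒≤ (<-≤-trans j<k k≤n)

  k∈ : k ∈[1, n ]
  k∈ = ≤-trans 1≤i (<⇒≤ i<k) , k≤n

open Ascending public

triples : ℕ → List (List ℕ)
triples n = choose 3 (oneTo n)

triple-ascending : ∀ {n t} → t ∈ triples n →
  ∃[ i ] ∃[ j ] ∃[ k ] t ≡ [ i , j , k ] × Ascending n i j k
triple-ascending {n} {t} t∈ = ascending t (choose-⊆ 3 (oneTo n) t∈) (choose-length 3 (oneTo n) t∈)
  where
  ascending : ∀ t → t ⊆ oneTo n → length t ≡ 3 →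
    ∃[ i ] ∃[ j ] ∃[ k ] t ≡ [ i , j , k ] × Ascending n i j k
  ascending [ i , j , k ] t⊆ refl
    with AllPairs-resp-⊇ t⊆ (oneTo-ascending n) | lookup t⊆ (here refl) | lookup t⊆ (there (there (here refl)))
  ... | (i<j ∷ _ ∷ []) ∷ (j<k ∷ []) ∷ [] ∷ [] | i∈ | k∈ =
    i , j , k , refl , record { 1≤i = proj₁ (∈oneTo⁻ i∈) ; i<j = i<j ; j<k = j<k ; k≤n = proj₂ (∈oneTo⁻ k∈) }

at-∈ : ∀ xs {i} → i < length xs → at xs i ∈ xs
at-∈ (x ∷ xs) {zero}  _         = here refl
at-∈ (x ∷ xs) {suc i} (s≤s i<) = there (at-∈ xs i<)

∈⇒at : ∀ {x} xs → x ∈ xs → ∃[ i ] i < length xs × at xs i ≡ x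
∈⇒at (y ∷ ys) (here refl) = 0 , s≤s z≤n , refl
∈⇒at (y ∷ ys) (there x∈)  = let (i , i< , e) = ∈⇒at ys x∈ in suc i , s≤s i< , e

at-map-applyUpTo : ∀ (g f : ℕ → ℕ) n {i} → i < n → at (map g (applyUpTo f n)) i ≡ g (f i)
at-map-applyUpTo g f (suc n) {zero}  _        = refl
at-map-applyUpTo g f (suc n) {suc i} (s≤s i<) = at-map-applyUpTo g (f ∘ suc) n i<

at-ext : ∀ xs ys → length xs ≡ length ys → (∀ {i} → i < length xs → at xs i ≡ at ys i) → xs ≡ ys
at-ext []       []       _ _  = refl
at-ext (x ∷ xs) (y ∷ ys) l eq =
  cong₂ _∷_ (eq (s≤s z≤n)) (at-ext xs ys (suc-injective l) (eq ∘ s≤s))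

deleteAt : ℕ → List ℕ → List ℕ
deleteAt _       []       = []
deleteAt zero    (x ∷ xs) = xs
deleteAt (suc i) (x ∷ xs) = x ∷ deleteAt i xs

length-deleteAt : ∀ xs {i} → i < length xs → suc (length (deleteAt i xs)) ≡ length xs
length-deleteAt (x ∷ xs) {zero}  _        = refl
length-deleteAt (x ∷ xs) {suc i} (s≤s i<) = cong suc (length-deleteAt xs i<)

at-∈-deleteAt : ∀ xs {i p} → p < length xs → p ≢ i → at xs p ∈ deleteAt i xs
at-∈-deleteAt (x ∷ xs) {zero}  {zero}  _        p≢i = ⊥-elim (p≢i refl)
at-∈-deleteAt (x ∷ xs) {zero}  {suc p} (s≤s p<) _   = at-∈ xs p<
at-∈-deleteAt (x ∷ xs) {suc i} {zero}  _        _   = here refl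
at-∈-deleteAt (x ∷ xs) {suc i} {suc p} (s≤s p<) p≢i = there (at-∈-deleteAt xs p< (p≢i ∘ cong suc))

-- Pigeonhole: a repeated entry could be deleted without losing any of the n values.
at-injective : ∀ {n} xs → length xs ≡ n → (∀ {v} → v ∈ oneTo n → v ∈ xs) →
  ∀ {i j} → i < n → j < n → at xs i ≡ at xs j → i ≡ j
at-injective {n} xs refl covers {i} {j} i< j< e with i ≟ j
... | yes i≡j = i≡j
... | no  i≢j = ⊥-elim (<-irrefl refl (begin-strict
    n                         ≡⟨ sym (length-applyUpTo suc n) ⟩
    length (oneTo n)          ≤⟨ unique⊆⇒length≤ (oneTo-unique n) covered ⟩
    length (deleteAt j xs)    <⟨ ≤-reflexive (length-deleteAt xs j<) ⟩
    length xs                 ∎))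
  where
  open ≤-Reasoning
  covered : ∀ {v} → v ∈ oneTo n → v ∈ deleteAt j xs
  covered v∈ with ∈⇒at xs (covers v∈)
  ... | p , p< , refl with p ≟ j
  ...   | no  p≢j  = at-∈-deleteAt xs p< p≢j
  ...   | yes refl = subst (_∈ deleteAt p xs) e (at-∈-deleteAt xs i< i≢j)

∈words⁻ : ∀ k xs {π} → π ∈ words k xs → length π ≡ k × All (_∈ xs) π
∈words⁻ zero    xs (here refl) = refl , []
∈words⁻ (suc k) xs π∈ with find (∈-concatMap⁻ (λ x → map (x ∷_) (words k xs)) {xs = xs} π∈)
... | x , x∈ , π∈′ with ∈-map⁻ (x ∷_) π∈′
...   | π′ , π′∈ , refl = let (l , a) = ∈words⁻ k xs π′∈ in cong suc l , x∈ ∷ a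

∈words⁺ : ∀ k xs {π} → length π ≡ k → All (_∈ xs) π → π ∈ words k xs
∈words⁺ zero    xs {[]}    _ _ = here refl
∈words⁺ (suc k) xs {x ∷ π} l (x∈ ∷ a) =
  ∈-concatMap⁺ (λ y → map (y ∷_) (words k xs))
    (lose x∈ (∈-map⁺ (x ∷_) (∈words⁺ k xs (suc-injective l) a)))

words-as-product : ∀ (xs : List ℕ) (ws : List (List ℕ)) →
  concatMap (λ x → map (x ∷_) ws) xs ≡ cartesianProductWith _∷_ xs ws
words-as-product []       ws = refl
words-as-product (x ∷ xs) ws = cong (map (x ∷_) ws ++_) (words-as-product xs ws)

words-unique : ∀ k {xs} → Unique xs → Unique (words k xs)
words-unique zero    u = [] ∷ []
words-unique (suc k) {xs} u rewrite words-as-product xs (words k xs) =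
  Unique.cartesianProductWith⁺ _∷_ (λ { refl → refl , refl }) u (words-unique k u)

S-unique : ∀ n → Unique (S n)
S-unique n = Unique.filter⁺ (λ π → T? (isPermᵇ n π)) (words-unique n (oneTo-unique n))

record IsPerm (n : ℕ) (π : List ℕ) : Set where
  field
    length≡        : length π ≡ n
    val-range      : ∀ {m} → m ∈[1, n ] → val π m ∈[1, n ]
    val-injective  : ∀ {m m′} → m ∈[1, n ] → m′ ∈[1, n ] → val π m ≡ val π m′ → m ≡ m′
    val-surjective : ∀ {v} → v ∈[1, n ] → ∃[ m ] m ∈[1, n ] × val π m ≡ v

open IsPerm public

∈S⁻ : ∀ {n π} → π ∈ S n → length π ≡ n × All (_∈ oneTo n) π × (∀ {v} → v ∈ oneTo n → v ∈ π)
∈S⁻ {n} {π} π∈ with ∈-filter⁻ (λ π → T? (isPermᵇ n π)) {xs = words n (oneTo n)} π∈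
... | π∈words , all-occur = proj₁ (∈words⁻ n (oneTo n) π∈words) , proj₂ (∈words⁻ n (oneTo n) π∈words) , covers
  where
  covers : ∀ {v} → v ∈ oneTo n → v ∈ π
  covers v∈ = Any.map (≡ᵇ⇒≡ _ _) (Any.any⁻ _ π (All.lookup (All.all⁺ _ (oneTo n) all-occur) v∈))

∈S⁺ : ∀ {n π} → length π ≡ n → All (_∈ oneTo n) π → (∀ {v} → v ∈ oneTo n → v ∈ π) → π ∈ S n
∈S⁺ {n} {π} l entries covers = ∈-filter⁺ (λ π → T? (isPermᵇ n π)) {xs = words n (oneTo n)}
  (∈words⁺ n (oneTo n) l entries)
  (All.all⁻ _ (All.tabulate λ v∈ → Any.any⁺ _ (Any.map (λ { {x} refl → ≡⇒≡ᵇ x x refl }) (covers v∈))))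

∈S⇒IsPerm : ∀ {n π} → π ∈ S n → IsPerm n π
∈S⇒IsPerm {n} {π} π∈ with ∈S⁻ π∈
... | l , entries , covers = record
  { length≡        = l
  ; val-range      = λ { {suc i} (_ , i<) → ∈oneTo⁻ (All.lookup entries (at-∈ π (subst (i <_) (sym l) i<))) }
  ; val-injective  = λ { {suc i} {suc i′} (_ , i<) (_ , i′<) e → cong suc (at-injective π l covers i< i′< e) }
  ; val-surjective = λ v∈ → let (i , i< , e) = ∈⇒at π (covers (∈oneTo⁺ v∈)) in
                            suc i , (s≤s z≤n , subst (i <_) l i<) , e
  }

IsPerm⇒∈S : ∀ {n π} → IsPerm n π → π ∈ S n
IsPerm⇒∈S {n} {π} P = ∈S⁺ (length≡ P) (All.tabulate entry) covered
  where
  entry : ∀ {x} → x ∈ π → x ∈ oneTo n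
  entry x∈ with ∈⇒at π x∈
  ... | i , i< , refl = ∈oneTo⁺ (val-range P (s≤s z≤n , subst (i <_) (length≡ P) i<))
  covered : ∀ {v} → v ∈ oneTo n → v ∈ π
  covered v∈ with val-surjective P (∈oneTo⁻ v∈)
  ... | suc i , (_ , i<) , refl = at-∈ π (subst (i <_) (sym (length≡ P)) i<)

-- Exchanging two entries

transpose : ℕ → ℕ → ℕ → ℕ
transpose p q m with m ≟ p | m ≟ q
... | yes _ | _     = q
... | no _  | yes _ = p
... | no _  | no _  = m

transpose-p : ∀ p q → transpose p q p ≡ q
transpose-p p q with p ≟ p
... | yes _   = refl
... | no  p≢p = ⊥-elim (p≢p refl)

transpose-q : ∀ p q → transpose p q q ≡ p
transpose-q p q with q ≟ p | q ≟ q
... | yes q≡p | _       = q≡p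
... | no  _   | yes _   = refl
... | no  _   | no  q≢q = ⊥-elim (q≢q refl)

transpose-other : ∀ {p q m} → m ≢ p → m ≢ q → transpose p q m ≡ m
transpose-other {p} {q} {m} m≢p m≢q with m ≟ p | m ≟ q
... | yes m≡p | _       = ⊥-elim (m≢p m≡p)
... | no  _   | yes m≡q = ⊥-elim (m≢q m≡q)
... | no  _   | no  _   = refl

transpose-involutive : ∀ p q m → transpose p q (transpose p q m) ≡ m
transpose-involutive p q m with m ≟ p | m ≟ q
... | yes refl | _        = transpose-q m q
... | no  _    | yes refl = transpose-p p m
... | no  m≢p  | no  m≢q  = transpose-other m≢p m≢q

transpose-range : ∀ {n p q m} → p ∈[1, n ] → q ∈[1, n ] → m ∈[1, n ] → transpose p q m ∈[1, n ]
transpose-range {p = p} {q} {m} p∈ q∈ m∈ with m ≟ p | m ≟ q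
... | yes _ | _     = q∈
... | no _  | yes _ = p∈
... | no _  | no _  = m∈

swapAt : ℕ → ℕ → ℕ → List ℕ → List ℕ
swapAt n p q π = map (val π ∘ transpose p q) (oneTo n)

module _ {n p q : ℕ} (p∈ : p ∈[1, n ]) (q∈ : q ∈[1, n ]) where

  val-swapAt : ∀ π {m} → m ∈[1, n ] → val (swapAt n p q π) m ≡ val π (transpose p q m)
  val-swapAt π {suc i} (_ , i<) = at-map-applyUpTo (val π ∘ transpose p q) suc n i<

  length-swapAt : ∀ π → length (swapAt n p q π) ≡ n
  length-swapAt π = trans (length-map _ (oneTo n)) (length-applyUpTo suc n)

  swapAt-involutive : ∀ {π} → length π ≡ n → swapAt n p q (swapAt n p q π) ≡ π
  swapAt-involutive {π} len = at-ext (swapAt n p q σ) π (trans (length-swapAt σ) (sym len)) λ {i} i< →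
    let i∈ = s≤s z≤n , subst (i <_) (length-swapAt σ) i< in begin
      val (swapAt n p q (swapAt n p q π)) (suc i)   ≡⟨ val-swapAt (swapAt n p q π) i∈ ⟩
      val (swapAt n p q π) (transpose p q (suc i))  ≡⟨ val-swapAt π (transpose-range p∈ q∈ i∈) ⟩
      val π (transpose p q (transpose p q (suc i))) ≡⟨ cong (val π) (transpose-involutive p q (suc i)) ⟩
      val π (suc i)                                 ∎
    where
    open ≡-Reasoning
    σ = swapAt n p q π

  IsPerm-swapAt : ∀ {π} → IsPerm n π → IsPerm n (swapAt n p q π)
  IsPerm-swapAt {π} P = record
    { length≡        = length-swapAt π
    ; val-range      = λ m∈ → subst (_∈[1, n ]) (sym (val-swapAt π m∈))
                                 (val-range P (transpose-range p∈ q∈ m∈))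
    ; val-injective  = injective
    ; val-surjective = λ v∈ → let (m , m∈ , e) = val-surjective P v∈ in
        transpose p q m , transpose-range p∈ q∈ m∈ ,
        trans (val-swapAt π (transpose-range p∈ q∈ m∈)) (trans (cong (val π) (transpose-involutive p q m)) e)
    }
    where
    open ≡-Reasoning
    injective : ∀ {m m′} → m ∈[1, n ] → m′ ∈[1, n ] →
      val (swapAt n p q π) m ≡ val (swapAt n p q π) m′ → m ≡ m′
    injective {m} {m′} m∈ m′∈ e = begin
      m                                ≡⟨ sym (transpose-involutive p q m) ⟩
      transpose p q (transpose p q m)  ≡⟨ cong (transpose p q) (val-injective P (transpose-range p∈ q∈ m∈)
                                            (transpose-range p∈ q∈ m′∈)
                                            (trans (sym (val-swapAt π m∈)) (trans e (val-swapAt π m′∈)))) ⟩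
      transpose p q (transpose p q m′) ≡⟨ transpose-involutive p q m′ ⟩
      m′                               ∎

-- Occurrences of 123 and 321

≮∧≯⇒≡ : ∀ {x y} → ¬ x < y → ¬ y < x → x ≡ y
≮∧≯⇒≡ x≮y y≮x = ≤-antisym (≮⇒≥ y≮x) (≮⇒≥ x≮y)

¬T⇒≡false : ∀ {b} → (T b → ⊥) → b ≡ false
¬T⇒≡false {false} _  = refl
¬T⇒≡false {true}  ¬t = ⊥-elim (¬t _)

<ᵇ-irrefl : ∀ m → (m <ᵇ m) ≡ false
<ᵇ-irrefl zero    = refl
<ᵇ-irrefl (suc m) = <ᵇ-irrefl m

<ᵇ-true : ∀ {m n} → m < n → (m <ᵇ n) ≡ true
<ᵇ-true m<n = Equivalence.to T-≡ (<⇒<ᵇ m<n)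

<ᵇ-false : ∀ {m n} → n ≤ m → (m <ᵇ n) ≡ false
<ᵇ-false {m} {n} n≤m = ¬T⇒≡false (λ m<ᵇn → <⇒≱ (<ᵇ⇒< m n m<ᵇn) n≤m)

≤ᵇ-true : ∀ {m n} → m ≤ n → (m ≤ᵇ n) ≡ true
≤ᵇ-true m≤n = Equivalence.to T-≡ (≤⇒≤ᵇ m≤n)

≤ᵇ-false : ∀ {m n} → n < m → (m ≤ᵇ n) ≡ false
≤ᵇ-false {m} {n} n<m = ¬T⇒≡false (λ m≤ᵇn → <⇒≱ n<m (≤ᵇ⇒≤ m n m≤ᵇn))

T-ext : ∀ {a b} → (T a → T b) → (T b → T a) → a ≡ b
T-ext {false} {false} _ _ = refl
T-ext {false} {true}  _ g = ⊥-elim (g _)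
T-ext {true}  {false} f _ = ⊥-elim (f _)
T-ext {true}  {true}  _ _ = refl

∧-cong-T : ∀ {a b c d} → a ≡ b → (T a → c ≡ d) → a ∧ c ≡ b ∧ d
∧-cong-T {false} refl _   = refl
∧-cong-T {true}  refl c≡d = c≡d _

orderIso123⁻ : ∀ x y z → T (orderIsoᵇ 3 [ x , y , z ] [ 1 , 2 , 3 ]) → x < y × y < z
orderIso123⁻ x y z
  rewrite <ᵇ-irrefl x | <ᵇ-irrefl y | <ᵇ-irrefl z
  with x <ᵇ y in x<y | x <ᵇ z | y <ᵇ x | y <ᵇ z in y<z
... | true  | true  | false | true  = λ _ → <ᵇ⇒< x y (Equivalence.from T-≡ x<y) , <ᵇ⇒< y z (Equivalence.from T-≡ y<z)
... | false | _     | _     | _     = λ ()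
... | true  | false | _     | _     = λ ()
... | true  | true  | true  | _     = λ ()
... | true  | true  | false | false = λ ()

orderIso321⁻ : ∀ x y z → T (orderIsoᵇ 3 [ x , y , z ] [ 3 , 2 , 1 ]) → z < y × y < x
orderIso321⁻ x y z
  rewrite <ᵇ-irrefl x | <ᵇ-irrefl y | <ᵇ-irrefl z
  with x <ᵇ y | x <ᵇ z | y <ᵇ x in y<x | y <ᵇ z | z <ᵇ x | z <ᵇ y in z<y
... | false | false | true  | false | true  | true  =
  λ _ → <ᵇ⇒< z y (Equivalence.from T-≡ z<y) , <ᵇ⇒< y x (Equivalence.from T-≡ y<x)
... | true  | _     | _     | _     | _     | _     = λ ()
... | false | true  | _     | _     | _     | _     = λ ()
... | false | false | false | _     | _     | _     = λ ()
... | false | false | true  | true  | _     | _     = λ ()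
... | false | false | true  | false | false | _     = λ ()
... | false | false | true  | false | true  | false = λ ()

orderIso123⁺ : ∀ {x y z} → x < y → y < z → T (orderIsoᵇ 3 [ x , y , z ] [ 1 , 2 , 3 ])
orderIso123⁺ {x} {y} {z} x<y y<z
  rewrite <ᵇ-irrefl x | <ᵇ-irrefl y | <ᵇ-irrefl z
        | <ᵇ-true x<y | <ᵇ-true y<z | <ᵇ-true (<-trans x<y y<z)
        | <ᵇ-false (<⇒≤ x<y) | <ᵇ-false (<⇒≤ y<z) | <ᵇ-false (<⇒≤ (<-trans x<y y<z)) = _

orderIso321⁺ : ∀ {x y z} → z < y → y < x → T (orderIsoᵇ 3 [ x , y , z ] [ 3 , 2 , 1 ])
orderIso321⁺ {x} {y} {z} z<y y<x
  rewrite <ᵇ-irrefl x | <ᵇ-irrefl y | <ᵇ-irrefl z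
        | <ᵇ-true z<y | <ᵇ-true y<x | <ᵇ-true (<-trans z<y y<x)
        | <ᵇ-false (<⇒≤ z<y) | <ᵇ-false (<⇒≤ y<x) | <ᵇ-false (<⇒≤ (<-trans z<y y<x)) = _

isort-ascending : ∀ {x y z} → x < y → y < z → isort [ x , y , z ] ≡ [ x , y , z ]
isort-ascending x<y y<z rewrite ≤ᵇ-true (<⇒≤ y<z) | ≤ᵇ-true (<⇒≤ x<y) = refl

isort-descending : ∀ {x y z} → z < y → y < x → isort [ x , y , z ] ≡ [ z , y , x ]
isort-descending z<y y<x rewrite ≤ᵇ-false z<y | ≤ᵇ-false (<-trans z<y y<x) | ≤ᵇ-false y<x = refl

mesh123 mesh321 : List (ℕ × ℕ) → MeshPattern
mesh123 R = mesh 3 [ 1 , 2 , 3 ] R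
mesh321 R = mesh 3 [ 3 , 2 , 1 ] R

record Occ (q : MeshPattern) (n : ℕ) (π : List ℕ) (i j k : ℕ) : Set where
  constructor occurrence
  field
    isOcc : T (isOccᵇ n q π [ i , j , k ])

open Occ public

-- Named copies of the local definitions of isOccᵇ: for an index triple,
-- isOccᵇ n (mesh 3 τ R) π [ i , j , k ] is by definition
-- orderIsoᵇ 3 (vals π i j k) τ ∧ boxesEmptyᵇ n π (columnBounds n i j k) (rowBounds n (vals π i j k)) R.
columnBounds : ℕ → ℕ → ℕ → ℕ → List ℕ
columnBounds n i j k = 0 ∷ i ∷ j ∷ k ∷ suc n ∷ []

rowBounds : ℕ → List ℕ → List ℕ
rowBounds n w = 0 ∷ isort w ++ suc n ∷ []

inBoxᵇ : List ℕ → List ℕ → ℕ × ℕ → ℕ → ℕ → Bool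
inBoxᵇ cs rs ab m v =
  (at cs (proj₁ ab) <ᵇ m) ∧ (m <ᵇ at cs (suc (proj₁ ab))) ∧
  (at rs (proj₂ ab) <ᵇ v) ∧ (v <ᵇ at rs (suc (proj₂ ab)))

boxesEmptyᵇ : ℕ → List ℕ → List ℕ → List ℕ → List (ℕ × ℕ) → Bool
boxesEmptyᵇ n π cs rs R = all (λ ab → not (any (λ m → inBoxᵇ cs rs ab m (val π m)) (oneTo n))) R

vals : List ℕ → ℕ → ℕ → ℕ → List ℕ
vals π i j k = [ val π i , val π j , val π k ]

at-ascending : ∀ {xs a b} → AllPairs _<_ xs → a < b → b < length xs → at xs a < at xs b
at-ascending {x ∷ xs} {zero}  {suc b} (x< ∷ _)   _         (s≤s b<) = All.lookup x< (at-∈ xs b<)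
at-ascending {x ∷ xs} {suc a} {suc b} (_ ∷ asc) (s≤s a<b) (s≤s b<) = at-ascending asc a<b b<

at-monotone : ∀ {xs a b} → AllPairs _<_ xs → a ≤ b → b < length xs → at xs a ≤ at xs b
at-monotone asc a≤b b< with m≤n⇒m<n∨m≡n a≤b
... | inj₁ a<b  = <⇒≤ (at-ascending asc a<b b<)
... | inj₂ refl = ≤-refl

at-ascending⁻ : ∀ {xs a b} → AllPairs _<_ xs → a < length xs → at xs a < at xs b → a < b
at-ascending⁻ asc a< xa<xb = ≰⇒> λ b≤a → <⇒≱ xa<xb (at-monotone asc b≤a a<)

record InGap (bs : List ℕ) (a m : ℕ) : Set where
  constructor gap
  field
    above : at bs a < m
    below : m < at bs (suc a)

open InGap public

index-in-range : ∀ {bs p m} → m < at bs p → p < length bs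
index-in-range {[]}     ()
index-in-range {x ∷ bs} {zero}  _ = s≤s z≤n
index-in-range {x ∷ bs} {suc p} m< = s≤s (index-in-range {bs} {p} m<)

gap-index-in-range : ∀ {bs a m} → InGap bs a m → a < length bs
gap-index-in-range {bs} {a} (gap _ u) = <-trans (n<1+n a) (index-in-range {bs} {suc a} u)

bound-in-no-gap : ∀ {bs a p} → AllPairs _<_ bs → p < length bs → ¬ InGap bs a (at bs p)
bound-in-no-gap {bs} {a} asc p< inside@(gap l u) =
  <-irrefl refl (<-≤-trans (at-ascending⁻ asc (gap-index-in-range inside) l) (≤-pred (at-ascending⁻ asc p< u)))

gap-unique : ∀ {bs a a′ m} → AllPairs _<_ bs → InGap bs a m → InGap bs a′ m → a ≡ a′
gap-unique {bs} {a} {a′} asc inside@(gap l u) inside′@(gap l′ u′) with <-cmp a a′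
... | tri< a<a′ _ _ = ⊥-elim (<-asym u (≤-<-trans (at-monotone asc a<a′ (gap-index-in-range inside′)) l′))
... | tri≈ _ a≡a′ _ = a≡a′
... | tri> _ _ a′<a = ⊥-elim (<-asym u′ (≤-<-trans (at-monotone asc a′<a (gap-index-in-range inside)) l))

columnBounds-ascending : ∀ {n i j k} → Ascending n i j k → AllPairs _<_ (columnBounds n i j k)
columnBounds-ascending asc =
  (1≤i asc ∷ proj₁ (j∈ asc) ∷ proj₁ (k∈ asc) ∷ s≤s z≤n ∷ []) ∷
  (i<j asc ∷ i<k asc ∷ s≤s (proj₂ (i∈ asc)) ∷ []) ∷
  (j<k asc ∷ s≤s (proj₂ (j∈ asc)) ∷ []) ∷
  (s≤s (k≤n asc) ∷ []) ∷ [] ∷ []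

column-avoids-occurrence : ∀ {n i j k a m} → Ascending n i j k → InGap (columnBounds n i j k) a m →
  m ≢ i × m ≢ j × m ≢ k
column-avoids-occurrence {a = a} asc inside =
  (λ { refl → bound-in-no-gap {a = a} {p = 1} (columnBounds-ascending asc) (s≤s (s≤s z≤n)) inside }) ,
  (λ { refl → bound-in-no-gap {a = a} {p = 2} (columnBounds-ascending asc) (s≤s (s≤s (s≤s z≤n))) inside }) ,
  (λ { refl → bound-in-no-gap {a = a} {p = 3} (columnBounds-ascending asc) (s≤s (s≤s (s≤s (s≤s z≤n)))) inside })

module _ {n i j k} (asc : Ascending n i j k) where

  boxesEmpty-swapAt : ∀ π rs R →
    boxesEmptyᵇ n (swapAt n i k π) (columnBounds n i j k) rs R ≡ boxesEmptyᵇ n π (columnBounds n i j k) rs R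
  boxesEmpty-swapAt π rs R = cong and (map-cong (λ ab → cong (not ∘ or) (map-cong-local (All.tabulate (same ab)))) R)
    where
    cs = columnBounds n i j k
    outside : ∀ {m} → ¬ (m ≢ i × m ≢ j × m ≢ k) → ∀ ab v → inBoxᵇ cs rs ab m v ≡ false
    outside {m} endpoint (a , b) v with at cs a <ᵇ m in c₁ | m <ᵇ at cs (suc a) in c₂
    ... | false | _     = refl
    ... | true  | false = refl
    ... | true  | true  = ⊥-elim (endpoint (column-avoids-occurrence {a = a} asc
                            (gap (<ᵇ⇒< _ _ (Equivalence.from T-≡ c₁)) (<ᵇ⇒< _ _ (Equivalence.from T-≡ c₂)))))
    both-outside : ∀ {m} → ¬ (m ≢ i × m ≢ j × m ≢ k) → ∀ ab v w → inBoxᵇ cs rs ab m v ≡ inBoxᵇ cs rs ab m w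
    both-outside endpoint ab v w = trans (outside endpoint ab v) (sym (outside endpoint ab w))
    same : ∀ ab {m} → m ∈ oneTo n → inBoxᵇ cs rs ab m (val (swapAt n i k π) m) ≡ inBoxᵇ cs rs ab m (val π m)
    same ab {m} m∈ with m ≟ i | m ≟ k
    ... | yes m≡i | _       = both-outside (λ (m≢i , _) → m≢i m≡i) ab _ _
    ... | no  _   | yes m≡k = both-outside (λ (_ , _ , m≢k) → m≢k m≡k) ab _ _
    ... | no  m≢i | no  m≢k = cong (inBoxᵇ cs rs ab m)
      (trans (val-swapAt (i∈ asc) (k∈ asc) π (∈oneTo⁻ m∈)) (cong (val π) (transpose-other m≢i m≢k)))

  -- The exchange keeps the set of values, hence the row bounds, and moves no other point.
  swapAt-occ123 : ∀ R π → isOccᵇ n (mesh123 R) (swapAt n i k π) [ i , j , k ] ≡ isOccᵇ n (mesh321 R) π [ i , j , k ]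
  swapAt-occ123 R π = begin
    orderIsoᵇ 3 (vals ρ i j k) [ 1 , 2 , 3 ] ∧ boxesEmptyᵇ n ρ cs (rowBounds n (vals ρ i j k)) R
      ≡⟨ cong (λ w → orderIsoᵇ 3 w [ 1 , 2 , 3 ] ∧ boxesEmptyᵇ n ρ cs (rowBounds n w) R) vals-ρ ⟩
    orderIsoᵇ 3 [ z , y , x ] [ 1 , 2 , 3 ] ∧ boxesEmptyᵇ n ρ cs (rowBounds n [ z , y , x ]) R
      ≡⟨ ∧-cong-T same-order same-boxes ⟩
    orderIsoᵇ 3 [ x , y , z ] [ 3 , 2 , 1 ] ∧ boxesEmptyᵇ n π cs (rowBounds n [ x , y , z ]) R
      ∎
    where
    open ≡-Reasoning
    ρ = swapAt n i k π
    cs = columnBounds n i j k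
    x = val π i
    y = val π j
    z = val π k
    j≢i : j ≢ i
    j≢i = >⇒≢ (i<j asc)
    j≢k : j ≢ k
    j≢k = <⇒≢ (j<k asc)
    vals-ρ : vals ρ i j k ≡ [ z , y , x ]
    vals-ρ = cong₂ _∷_
      (trans (val-swapAt (i∈ asc) (k∈ asc) π (i∈ asc)) (cong (val π) (transpose-p i k)))
      (cong₂ _∷_ (trans (val-swapAt (i∈ asc) (k∈ asc) π (j∈ asc)) (cong (val π) (transpose-other j≢i j≢k)))
      (cong (_∷ []) (trans (val-swapAt (i∈ asc) (k∈ asc) π (k∈ asc)) (cong (val π) (transpose-q i k)))))
    same-order : orderIsoᵇ 3 [ z , y , x ] [ 1 , 2 , 3 ] ≡ orderIsoᵇ 3 [ x , y , z ] [ 3 , 2 , 1 ]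
    same-order = T-ext
      (λ o → let (z<y , y<x) = orderIso123⁻ z y x o in orderIso321⁺ z<y y<x)
      (λ o → let (z<y , y<x) = orderIso321⁻ x y z o in orderIso123⁺ z<y y<x)
    same-boxes : T (orderIsoᵇ 3 [ z , y , x ] [ 1 , 2 , 3 ]) →
      boxesEmptyᵇ n ρ cs (rowBounds n [ z , y , x ]) R ≡ boxesEmptyᵇ n π cs (rowBounds n [ x , y , z ]) R
    same-boxes o = let (z<y , y<x) = orderIso123⁻ z y x o in
      trans (boxesEmpty-swapAt π (rowBounds n [ z , y , x ]) R)
        (cong (λ w → boxesEmptyᵇ n π cs (0 ∷ w ++ suc n ∷ []) R)
          (trans (isort-ascending z<y y<x) (sym (isort-descending z<y y<x))))

swapAt-occ321 : ∀ {n i j k} → Ascending n i j k → ∀ R {π} → length π ≡ n →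
  isOccᵇ n (mesh321 R) (swapAt n i k π) [ i , j , k ] ≡ isOccᵇ n (mesh123 R) π [ i , j , k ]
swapAt-occ321 {n} {i} {j} {k} asc R {π} len = begin
  isOccᵇ n (mesh321 R) (swapAt n i k π) [ i , j , k ]
    ≡⟨ sym (swapAt-occ123 asc R (swapAt n i k π)) ⟩
  isOccᵇ n (mesh123 R) (swapAt n i k (swapAt n i k π)) [ i , j , k ]
    ≡⟨ cong (λ σ → isOccᵇ n (mesh123 R) σ [ i , j , k ]) (swapAt-involutive {n} {i} {k} (i∈ asc) (k∈ asc) {π} len) ⟩
  isOccᵇ n (mesh123 R) π [ i , j , k ]
    ∎
  where open ≡-Reasoning

-- The involution

occursᵇ : List (ℕ × ℕ) → ℕ → List ℕ → List ℕ → Bool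
occursᵇ R n π t = isOccᵇ n (mesh123 R) π t ∨ isOccᵇ n (mesh321 R) π t

Occurs : List (ℕ × ℕ) → ℕ → List ℕ → ℕ → ℕ → ℕ → Set
Occurs R n π i j k = Occ (mesh123 R) n π i j k ⊎ Occ (mesh321 R) n π i j k

occursᵇ⇒Occurs : ∀ {R n π i j k} → T (occursᵇ R n π [ i , j , k ]) → Occurs R n π i j k
occursᵇ⇒Occurs = Sum.map occurrence occurrence ∘ Equivalence.to T-∨

Occurs⇒occursᵇ : ∀ {R n π i j k} → Occurs R n π i j k → T (occursᵇ R n π [ i , j , k ])
Occurs⇒occursᵇ = Equivalence.from T-∨ ∘ Sum.map isOcc isOcc

EndsShared : List (ℕ × ℕ) → Set
EndsShared R = ∀ {n π i j k i′ j′ k′} → IsPerm n π → Ascending n i j k → Ascending n i′ j′ k′ →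
  Occurs R n π i j k → Occurs R n π i′ j′ k′ → i ≡ i′ × k ≡ k′

swapOuterAt : ℕ → List ℕ → Maybe (List ℕ) → List ℕ
swapOuterAt n π (just t) = swapAt n (at t 0) (at t 2) π
swapOuterAt n π nothing  = π

swapOuter : List (ℕ × ℕ) → ℕ → List ℕ → List ℕ
swapOuter R n π = swapOuterAt n π (head (filter (T? ∘ occursᵇ R n π) (triples n)))

data SwapOuterSpec (R : List (ℕ × ℕ)) (n : ℕ) (π : List ℕ) : List ℕ → Set where
  unchanged : (∀ {t} → t ∈ triples n → ¬ T (occursᵇ R n π t)) → SwapOuterSpec R n π π
  swapped   : ∀ {i j k} → [ i , j , k ] ∈ triples n → Ascending n i j k → Occurs R n π i j k →
              SwapOuterSpec R n π (swapAt n i k π)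

swapOuter-spec : ∀ R n π → SwapOuterSpec R n π (swapOuter R n π)
swapOuter-spec R n π with filter (T? ∘ occursᵇ R n π) (triples n) in e
... | [] = unchanged λ t∈ o → Any.¬Any[] (subst (_ ∈_) e (∈-filter⁺ (T? ∘ occursᵇ R n π) t∈ o))
... | t ∷ _ with ∈-filter⁻ (T? ∘ occursᵇ R n π) {xs = triples n} (subst (t ∈_) (sym e) (here refl))
...   | t∈ , o with triple-ascending {n} t∈
...     | i , j , k , refl , asc = swapped t∈ asc (occursᵇ⇒Occurs o)

record SwapOuterFacts (R : List (ℕ × ℕ)) (n : ℕ) (π σ : List ℕ) : Set where
  field
    perm       : IsPerm n σ
    involutive : swapOuter R n σ ≡ π
    occ123     : occ n (mesh123 R) σ ≡ occ n (mesh321 R) π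
    occ321     : occ n (mesh321 R) σ ≡ occ n (mesh123 R) π

swapOuter-fixed : ∀ {R n π} → (∀ {t} → t ∈ triples n → ¬ T (occursᵇ R n π t)) → swapOuter R n π ≡ π
swapOuter-fixed {R} {n} {π} none with swapOuter R n π | swapOuter-spec R n π
... | _ | unchanged _    = refl
... | _ | swapped t∈ _ o = ⊥-elim (none t∈ (Occurs⇒occursᵇ o))

module _ {R : List (ℕ × ℕ)} (shared : EndsShared R) {n π i j k}
         (P : IsPerm n π) (t∈ : [ i , j , k ] ∈ triples n) (asc : Ascending n i j k) (o : Occurs R n π i j k) where

  private
    ρ = swapAt n i k π
    ρ-perm = IsPerm-swapAt {n} {i} {k} (i∈ asc) (k∈ asc) P

    ρ-occurs : Occurs R n ρ i j k
    ρ-occurs = Sum.swap (Sum.map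
      (λ o₁ → occurrence (subst T (sym (swapAt-occ321 asc R {π} (length≡ P))) (isOcc o₁)))
      (λ o₂ → occurrence (subst T (sym (swapAt-occ123 asc R π)) (isOcc o₂)))
      o)

    -- Neither π nor ρ has an occurrence at a triple with other ends, as both have one with ends i and k.
    absent : ∀ {i′ j′ k′} → Ascending n i′ j′ k′ → ¬ (i ≡ i′ × k ≡ k′) →
      isOccᵇ n (mesh123 R) ρ [ i′ , j′ , k′ ] ≡ isOccᵇ n (mesh321 R) π [ i′ , j′ , k′ ] ×
      isOccᵇ n (mesh321 R) ρ [ i′ , j′ , k′ ] ≡ isOccᵇ n (mesh123 R) π [ i′ , j′ , k′ ]
    absent {i′} {j′} {k′} asc′ other =
      trans (not-in ρ-perm ρ-occurs (inj₁ ∘ occurrence)) (sym (not-in P o (inj₂ ∘ occurrence))) ,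
      trans (not-in ρ-perm ρ-occurs (inj₂ ∘ occurrence)) (sym (not-in P o (inj₁ ∘ occurrence)))
      where
      not-in : ∀ {σ b} → IsPerm n σ → Occurs R n σ i j k → (T b → Occurs R n σ i′ j′ k′) → b ≡ false
      not-in Pσ oσ as-occurrence = ¬T⇒≡false (other ∘ shared Pσ asc asc′ oσ ∘ as-occurrence)

  swapAt-exchanges-occurrences : ∀ {s} → s ∈ triples n →
    isOccᵇ n (mesh123 R) ρ s ≡ isOccᵇ n (mesh321 R) π s × isOccᵇ n (mesh321 R) ρ s ≡ isOccᵇ n (mesh123 R) π s
  swapAt-exchanges-occurrences s∈ with triple-ascending {n} s∈
  ... | i′ , j′ , k′ , refl , asc′ with i′ ≟ i | k′ ≟ k
  ... | yes refl | yes refl = swapAt-occ123 asc′ R π , swapAt-occ321 asc′ R {π} (length≡ P)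
  ... | no i′≢i  | _        = absent asc′ (i′≢i ∘ sym ∘ proj₁)
  ... | yes _    | no k′≢k  = absent asc′ (k′≢k ∘ sym ∘ proj₂)

  swapAt-facts : SwapOuterFacts R n π ρ
  swapAt-facts = record
    { perm       = ρ-perm
    ; involutive = back
    ; occ123     = length-filter-cong (triples n) (proj₁ ∘ swapAt-exchanges-occurrences)
    ; occ321     = length-filter-cong (triples n) (proj₂ ∘ swapAt-exchanges-occurrences)
    }
    where
    back : swapOuter R n ρ ≡ π
    back with swapOuter R n ρ | swapOuter-spec R n ρ
    ... | _ | unchanged none = ⊥-elim (none t∈ (Occurs⇒occursᵇ ρ-occurs))
    ... | _ | swapped _ asc′ o′ with shared ρ-perm asc asc′ ρ-occurs o′
    ...   | refl , refl = swapAt-involutive {n} {i} {k} (i∈ asc) (k∈ asc) (length≡ P)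

swapOuter-facts : ∀ {R} → EndsShared R → ∀ {n π} → IsPerm n π → SwapOuterFacts R n π (swapOuter R n π)
swapOuter-facts {R} shared {n} {π} P with swapOuter R n π | swapOuter-spec R n π
... | _ | swapped t∈ asc o = swapAt-facts shared P t∈ asc o
... | _ | unchanged none = record
  { perm = P ; involutive = swapOuter-fixed {R} {n} none ; occ123 = no-occurrences ; occ321 = sym no-occurrences }
  where
  no-occurrences : occ n (mesh123 R) π ≡ occ n (mesh321 R) π
  no-occurrences = length-filter-cong (triples n) λ s∈ →
    trans (¬T⇒≡false (none s∈ ∘ Equivalence.from T-∨ ∘ inj₁))
          (sym (¬T⇒≡false (none s∈ ∘ Equivalence.from T-∨ ∘ inj₂)))

endsShared⇒jointlyEquidistributed : ∀ {R} → EndsShared R → JointlyEquidistributed (mesh123 R) (mesh321 R)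
endsShared⇒jointlyEquidistributed {R} shared n _ k ℓ =
  length-filter-involution (counts k ℓ) (counts ℓ k) (swapOuter R n) (S-unique n)
    (λ π∈ → IsPerm⇒∈S (perm (facts π∈)))
    (involutive ∘ facts)
    (λ {π} π∈ → begin
      counts k ℓ (swapOuter R n π)
        ≡⟨ cong₂ (λ a b → (a ≡ᵇ k) ∧ (b ≡ᵇ ℓ)) (occ123 (facts π∈)) (occ321 (facts π∈)) ⟩
      (occ n (mesh321 R) π ≡ᵇ k) ∧ (occ n (mesh123 R) π ≡ᵇ ℓ)
        ≡⟨ ∧-comm (occ n (mesh321 R) π ≡ᵇ k) _ ⟩
      counts ℓ k π
        ∎)
  where
  open ≡-Reasoning
  open SwapOuterFacts
  counts : ℕ → ℕ → List ℕ → Bool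
  counts a b π = (occ n (mesh123 R) π ≡ᵇ a) ∧ (occ n (mesh321 R) π ≡ᵇ b)
  facts : ∀ {π} → π ∈ S n → SwapOuterFacts R n π (swapOuter R n π)
  facts = swapOuter-facts shared ∘ ∈S⇒IsPerm

-- Locating the points outside an occurrence

pairEqᵇ-sound : ∀ p q → T (pairEqᵇ p q) → p ≡ q
pairEqᵇ-sound (a , b) (c , d) eq with Equivalence.to T-∧ eq
... | a≡c , b≡d = cong₂ _,_ (≡ᵇ⇒≡ a c a≡c) (≡ᵇ⇒≡ b d b≡d)

∈gridMinus⁺ : ∀ {xs a b} → a < 4 → b < 4 → (a , b) ∉ xs → (a , b) ∈ gridMinus xs
∈gridMinus⁺ {xs} {a} {b} a< b< ab∉ =
  ∈-filter⁺ (λ p → T? (not (any (pairEqᵇ p) xs))) {xs = grid4}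
    (∈-concatMap⁺ (λ a → map (a ,_) (upTo 4)) (lose (∈-upTo⁺ a<) (∈-map⁺ (a ,_) (∈-upTo⁺ b<))))
    (Equivalence.from T-not-≡ (¬T⇒≡false λ t → ab∉ (found (Any.any⁻ (pairEqᵇ (a , b)) xs t))))
  where
  found : Any.Any (T ∘ pairEqᵇ (a , b)) xs → (a , b) ∈ xs
  found = Any.map (pairEqᵇ-sound _ _)

gap-containing : ∀ {e₀ e₁ e₂ e₃ e₄ v} → e₀ < v → v < e₄ → v ≢ e₁ → v ≢ e₂ → v ≢ e₃ →
  ∃[ a ] a < 4 × InGap (e₀ ∷ e₁ ∷ e₂ ∷ e₃ ∷ e₄ ∷ []) a v
gap-containing {e₁ = e₁} {e₂} {e₃} {v = v} l u v≢e₁ v≢e₂ v≢e₃ with <-cmp v e₁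
... | tri< v<e₁ _ _     = 0 , s≤s z≤n , gap l v<e₁
... | tri≈ _ v≡e₁ _     = ⊥-elim (v≢e₁ v≡e₁)
... | tri> _ _ e₁<v with <-cmp v e₂
...   | tri< v<e₂ _ _   = 1 , s≤s (s≤s z≤n) , gap e₁<v v<e₂
...   | tri≈ _ v≡e₂ _   = ⊥-elim (v≢e₂ v≡e₂)
...   | tri> _ _ e₂<v with <-cmp v e₃
...     | tri< v<e₃ _ _ = 2 , s≤s (s≤s (s≤s z≤n)) , gap e₂<v v<e₃
...     | tri≈ _ v≡e₃ _ = ⊥-elim (v≢e₃ v≡e₃)
...     | tri> _ _ e₃<v = 3 , ≤-refl , gap e₃<v u

occurrence-box-empty : ∀ {n τ R π i j k ab m} → Occ (mesh 3 τ R) n π i j k → ab ∈ R → m ∈ oneTo n →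
  ¬ T (inBoxᵇ (columnBounds n i j k) (rowBounds n (vals π i j k)) ab m (val π m))
occurrence-box-empty {R = R} o ab∈ m∈ inside =
  subst T (Equivalence.to T-not-≡ empty) (Any.any⁺ _ (Any.map (λ { refl → inside }) m∈))
  where
  empty = All.lookup (All.all⁺ _ R (proj₂ (Equivalence.to T-∧ (isOcc o)))) ab∈

data InUnshadedBox (xs : List (ℕ × ℕ)) (cs rs : List ℕ) (m v : ℕ) : Set where
  box : ∀ {a b} → (a , b) ∈ xs → InGap cs a m → InGap rs b v → InUnshadedBox xs cs rs m v

InBox123 InBox321 : List (ℕ × ℕ) → ℕ → List ℕ → ℕ → ℕ → ℕ → ℕ → Set
InBox123 xs n π i j k m =
  InUnshadedBox xs (columnBounds n i j k) (0 ∷ val π i ∷ val π j ∷ val π k ∷ suc n ∷ []) m (val π m)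
InBox321 xs n π i j k m =
  InUnshadedBox xs (columnBounds n i j k) (0 ∷ val π k ∷ val π j ∷ val π i ∷ suc n ∷ []) m (val π m)

locate : ∀ xs τ {n π i j k s₁ s₂ s₃} → IsPerm n π → Ascending n i j k →
  Occ (mesh 3 τ (gridMinus xs)) n π i j k → isort (vals π i j k) ≡ [ s₁ , s₂ , s₃ ] →
  ∀ {m} → m ∈[1, n ] → m ≢ i → m ≢ j → m ≢ k → val π m ≢ s₁ → val π m ≢ s₂ → val π m ≢ s₃ →
  InUnshadedBox xs (columnBounds n i j k) (0 ∷ s₁ ∷ s₂ ∷ s₃ ∷ suc n ∷ []) m (val π m)
locate xs τ {n} {π} {i} {j} {k} P asc o sorted {m} m∈ m≢i m≢j m≢k v≢s₁ v≢s₂ v≢s₃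
  with gap-containing (proj₁ m∈) (s≤s (proj₂ m∈)) m≢i m≢j m≢k
     | gap-containing (proj₁ (val-range P m∈)) (s≤s (proj₂ (val-range P m∈))) v≢s₁ v≢s₂ v≢s₃
... | a , a< , col | b , b< , row with (a , b) ∈? xs
...   | yes ab∈ = box ab∈ col row
...   | no  ab∉ = ⊥-elim (occurrence-box-empty o (∈gridMinus⁺ a< b< ab∉) (∈oneTo⁺ m∈) inside)
  where
  row′ : InGap (rowBounds n (vals π i j k)) b (val π m)
  row′ = subst (λ w → InGap (0 ∷ w ++ suc n ∷ []) b (val π m)) (sym sorted) row
  inside : T (inBoxᵇ (columnBounds n i j k) (rowBounds n (vals π i j k)) (a , b) m (val π m))
  inside = Equivalence.from T-∧ (<⇒<ᵇ (above col) , Equivalence.from T-∧ (<⇒<ᵇ (below col) ,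
           Equivalence.from T-∧ (<⇒<ᵇ (above row′) , <⇒<ᵇ (below row′))))

increasing : ∀ {R n π i j k} → Occ (mesh123 R) n π i j k → val π i < val π j × val π j < val π k
increasing o = orderIso123⁻ _ _ _ (proj₁ (Equivalence.to T-∧ (isOcc o)))

decreasing : ∀ {R n π i j k} → Occ (mesh321 R) n π i j k → val π k < val π j × val π j < val π i
decreasing o = orderIso321⁻ _ _ _ (proj₁ (Equivalence.to T-∧ (isOcc o)))

module _ (xs : List (ℕ × ℕ)) {n π i j k} (P : IsPerm n π) (asc : Ascending n i j k) where

  private
    distinct-values : ∀ {m p} → m ∈[1, n ] → p ∈[1, n ] → m ≢ p → val π m ≢ val π p
    distinct-values m∈ p∈ m≢p = m≢p ∘ val-injective P m∈ p∈

  locate123 : Occ (mesh123 (gridMinus xs)) n π i j k →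
    ∀ {m} → m ∈[1, n ] → m ≢ i → m ≢ j → m ≢ k →
    InBox123 xs n π i j k m
  locate123 o m∈ m≢i m≢j m≢k =
    let (x<y , y<z) = increasing o in
    locate xs [ 1 , 2 , 3 ] P asc o (isort-ascending x<y y<z) m∈ m≢i m≢j m≢k
      (distinct-values m∈ (i∈ asc) m≢i) (distinct-values m∈ (j∈ asc) m≢j) (distinct-values m∈ (k∈ asc) m≢k)

  locate321 : Occ (mesh321 (gridMinus xs)) n π i j k →
    ∀ {m} → m ∈[1, n ] → m ≢ i → m ≢ j → m ≢ k →
    InBox321 xs n π i j k m
  locate321 o m∈ m≢i m≢j m≢k =
    let (z<y , y<x) = decreasing o in
    locate xs [ 3 , 2 , 1 ] P asc o (isort-descending z<y y<x) m∈ m≢i m≢j m≢k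
      (distinct-values m∈ (k∈ asc) m≢k) (distinct-values m∈ (j∈ asc) m≢j) (distinct-values m∈ (i∈ asc) m≢i)

Locator : List (ℕ × ℕ) → ℕ → ℕ → ℕ → ℕ → Set
Locator xs n i j k = ∀ {m} → m ∈[1, n ] → m ≢ i → m ≢ j → m ≢ k →
  ∃[ a ] ∃[ b ] (a , b) ∈ xs × InGap (columnBounds n i j k) a m

occurs-locator : ∀ xs {n π i j k} → IsPerm n π → Ascending n i j k →
  Occurs (gridMinus xs) n π i j k → Locator xs n i j k
occurs-locator xs P asc (inj₁ o) m∈ m≢i m≢j m≢k with locate123 xs P asc o m∈ m≢i m≢j m≢k
... | box ab∈ col _ = _ , _ , ab∈ , col
occurs-locator xs P asc (inj₂ o) m∈ m≢i m≢j m≢k with locate321 xs P asc o m∈ m≢i m≢j m≢k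
... | box ab∈ col _ = _ , _ , ab∈ , col

-- Stated as a Boolean so that it is checked by evaluation for a concrete list of boxes.
ColumnFree : ℕ → List (ℕ × ℕ) → Set
ColumnFree a xs = T (all (λ p → not (proj₁ p ≡ᵇ a)) xs)

columnFree⇒∉ : ∀ {a xs} → ColumnFree a xs → ∀ b → (a , b) ∉ xs
columnFree⇒∉ {a} {(.a , b) ∷ xs} free b (here refl) =
  subst T (Equivalence.to T-not-≡ (proj₁ (Equivalence.to T-∧ free))) (≡⇒≡ᵇ a a refl)
columnFree⇒∉ {a} {p ∷ xs} free b (there ab∈) = columnFree⇒∉ {a} {xs} (proj₂ (Equivalence.to T-∧ free)) b ab∈

free-column-has-no-points : ∀ {xs n i j k a} → ColumnFree a xs → Ascending n i j k → Locator xs n i j k →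
  ∀ {m} → m ∈[1, n ] → ¬ InGap (columnBounds n i j k) a m
free-column-has-no-points {xs} {a = a} free asc loc m∈ inside
  with column-avoids-occurrence asc inside
... | m≢i , m≢j , m≢k with loc m∈ m≢i m≢j m≢k
...   | a′ , b , a′b∈ , inside′ with gap-unique {a = a} {a′ = a′} (columnBounds-ascending asc) inside inside′
...     | refl = columnFree⇒∉ {xs = xs} free b a′b∈

column-bounds-adjacent : ∀ {xs n i j k} a → a < 4 → ColumnFree a xs → Ascending n i j k → Locator xs n i j k →
  at (columnBounds n i j k) (suc a) ≡ suc (at (columnBounds n i j k) a)
column-bounds-adjacent {xs} {n} {i} {j} {k} a a<4 free asc loc
  with at (columnBounds n i j k) (suc a) ≟ suc (at (columnBounds n i j k) a)
... | yes adjacent = adjacent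
... | no  apart    = ⊥-elim (free-column-has-no-points free asc loc m∈ inside)
  where
  cs = columnBounds n i j k
  inside : InGap cs a (suc (at cs a))
  inside = gap ≤-refl (≤∧≢⇒< (at-ascending (columnBounds-ascending asc) (n<1+n a) (s≤s a<4)) (apart ∘ sym))
  m∈ : suc (at cs a) ∈[1, n ]
  m∈ = s≤s z≤n , ≤-pred (<-≤-trans (below inside) (at-monotone (columnBounds-ascending asc) a<4 ≤-refl))

-- The ten shadings

module _ {xs n i j k} (asc : Ascending n i j k) (loc : Locator xs n i j k) where

  first≡1 : ColumnFree 0 xs → i ≡ 1
  first≡1 free = column-bounds-adjacent 0 (s≤s z≤n) free asc loc

  middle≡suc-first : ColumnFree 1 xs → j ≡ suc i
  middle≡suc-first free = column-bounds-adjacent 1 (s≤s (s≤s z≤n)) free asc loc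

  last≡suc-middle : ColumnFree 2 xs → k ≡ suc j
  last≡suc-middle free = column-bounds-adjacent 2 (s≤s (s≤s (s≤s z≤n))) free asc loc

  last≡n : ColumnFree 3 xs → k ≡ n
  last≡n free = sym (suc-injective (column-bounds-adjacent 3 ≤-refl free asc loc))

fixed-ends⇒endsShared : ∀ xs (first last : ℕ → ℕ) →
  (∀ {n i j k} → Ascending n i j k → Locator xs n i j k → i ≡ first n × k ≡ last n) →
  EndsShared (gridMinus xs)
fixed-ends⇒endsShared xs first last fixed P asc asc′ o o′
  with fixed asc (occurs-locator xs P asc o) | fixed asc′ (occurs-locator xs P asc′ o′)
... | refl , refl | refl , refl = refl , refl

outerColumnsFree⇒endsShared : ∀ xs → ColumnFree 0 xs → ColumnFree 3 xs → EndsShared (gridMinus xs)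
outerColumnsFree⇒endsShared xs free₀ free₃ =
  fixed-ends⇒endsShared xs (λ _ → 1) (λ n → n) λ asc loc → first≡1 asc loc free₀ , last≡n asc loc free₃

endsShared-S9 : EndsShared (gridMinus ((3 , 3) ∷ []))
endsShared-S9 = fixed-ends⇒endsShared xs (λ _ → 1) (λ _ → 3) λ asc loc →
  let i≡1 = first≡1 asc loc _
      j≡2 = trans (middle≡suc-first asc loc _) (cong suc i≡1)
  in i≡1 , trans (last≡suc-middle asc loc _) (cong suc j≡2)
  where
  xs = (3 , 3) ∷ []

endsShared-S10 : EndsShared (gridMinus ((0 , 0) ∷ []))
endsShared-S10 = fixed-ends⇒endsShared xs (_∸ 2) (λ n → n) λ {n} {i} {j} {k} asc loc →
  let k≡n = last≡n asc loc _
      n≡i+2 = begin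
        n             ≡⟨ sym k≡n ⟩
        k             ≡⟨ last≡suc-middle asc loc _ ⟩
        suc j         ≡⟨ cong suc (middle≡suc-first asc loc _) ⟩
        suc (suc i)   ∎
  in sym (cong (_∸ 2) n≡i+2) , k≡n
  where
  open ≡-Reasoning
  xs = (0 , 0) ∷ []

module Case17 where

  xs : List (ℕ × ℕ)
  xs = (1 , 2) ∷ (2 , 1) ∷ (3 , 3) ∷ []

  Occ123 Occ321 : ℕ → List ℕ → ℕ → ℕ → ℕ → Set
  Occ123 = Occ (mesh123 (gridMinus xs))
  Occ321 = Occ (mesh321 (gridMinus xs))

  module _ {n : ℕ} {π : List ℕ} {i : ℕ} (P : IsPerm n π) where

    no-later-123 : ∀ {j k j′ k′} → Ascending n i j k → Ascending n i j′ k′ →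
      Occ123 n π i j k → Occ123 n π i j′ k′ → ¬ k < k′
    no-later-123 {j} {k} {j′} {k′} asc asc′ o o′ k<k′ with k ≟ j′
    ... | yes refl =
      j-misplaced (locate123 xs P asc′ o′ (j∈ asc) (>⇒≢ (i<j asc)) (<⇒≢ (j<k asc)) (<⇒≢ (<-trans (j<k asc) k<k′)))
      where
      j-misplaced : ¬ InBox123 xs n π i k k′ j
      j-misplaced (box (here refl) _ (gap π-k<π-j _)) = <-asym π-k<π-j (proj₂ (increasing o))
      j-misplaced (box (there (here refl)) (gap k<j _) _) = <-asym k<j (j<k asc)
      j-misplaced (box (there (there (here refl))) (gap k′<j _) _) = <-asym k′<j (<-trans (j<k asc) k<k′)
      j-misplaced (box (there (there (there ()))) _ _)
    ... | no k≢j′ = k-misplaced (locate123 xs P asc′ o′ (k∈ asc) (>⇒≢ (i<k asc)) k≢j′ (<⇒≢ k<k′))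
      where
      π-j<π-k = proj₂ (increasing o)
      j′-after-k : k < j′ → val π j′ < val π k → ⊥
      j′-after-k k<j′ π-j′<π-k
        with locate123 xs P asc o (j∈ asc′) (>⇒≢ (i<j asc′)) (>⇒≢ (<-trans (j<k asc) k<j′)) (>⇒≢ k<j′)
      ... | box (here refl) (gap _ j′<j) _ = <-asym j′<j (<-trans (j<k asc) k<j′)
      ... | box (there (here refl)) (gap _ j′<k) _ = <-asym j′<k k<j′
      ... | box (there (there (here refl))) _ (gap π-k<π-j′ _) = <-asym π-k<π-j′ π-j′<π-k
      ... | box (there (there (there ()))) _ _
      j′-before-k : j′ < k → val π k < val π j′ → ⊥
      j′-before-k j′<k π-k<π-j′ with j′ ≟ j
      ... | yes refl = <-asym π-k<π-j′ π-j<π-k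
      ... | no j′≢j with locate123 xs P asc o (j∈ asc′) (>⇒≢ (i<j asc′)) j′≢j (<⇒≢ j′<k)
      ...   | box (here refl) _ (gap _ π-j′<π-k) = <-asym π-j′<π-k π-k<π-j′
      ...   | box (there (here refl)) _ (gap _ π-j′<π-j) = <-asym (<-trans π-j′<π-j π-j<π-k) π-k<π-j′
      ...   | box (there (there (here refl))) (gap k<j′ _) _ = <-asym k<j′ j′<k
      ...   | box (there (there (there ()))) _ _
      k-misplaced : ¬ InBox123 xs n π i j′ k′ k
      k-misplaced (box (here refl) (gap _ k<j′) (gap π-j′<π-k _)) = j′-after-k k<j′ π-j′<π-k
      k-misplaced (box (there (here refl)) (gap j′<k _) (gap _ π-k<π-j′)) = j′-before-k j′<k π-k<π-j′
      k-misplaced (box (there (there (here refl))) (gap k′<k _) _) = <-asym k′<k k<k′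
      k-misplaced (box (there (there (there ()))) _ _)

    no-later-321 : ∀ {j k j′ k′} → Ascending n i j k → Ascending n i j′ k′ →
      Occ321 n π i j k → Occ321 n π i j′ k′ → ¬ k < k′
    no-later-321 {j} {k} {j′} {k′} asc asc′ o o′ k<k′
      with locate321 xs P asc o (k∈ asc′) (>⇒≢ (i<k asc′)) (>⇒≢ (<-trans (j<k asc) k<k′)) (>⇒≢ k<k′)
    ... | box (here refl) (gap _ k′<j) _ = <-asym k′<j (<-trans (j<k asc) k<k′)
    ... | box (there (here refl)) (gap _ k′<k) _ = <-asym k′<k k<k′
    ... | box (there (there (here refl))) _ (gap π-i<π-k′ _) =
          <-asym π-i<π-k′ (<-trans (proj₁ (decreasing o′)) (proj₂ (decreasing o′)))
    ... | box (there (there (there ()))) _ _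

    not-both : ∀ {j k j′ k′} → Ascending n i j k → Ascending n i j′ k′ → Occ123 n π i j k → Occ321 n π i j′ k′ → ⊥
    not-both {j} {k} {j′} {k′} asc asc′ o o′ =
      k′-misplaced (locate123 xs P asc o (k∈ asc′) (>⇒≢ (i<k asc′)) (λ { refl → <-asym π-k′<π-i π-i<π-j })
                                                    (λ { refl → <-asym π-k′<π-i π-i<π-k }))
      where
      π-i<π-j = proj₁ (increasing o)
      π-i<π-k = <-trans π-i<π-j (proj₂ (increasing o))
      π-k′<π-i = <-trans (proj₁ (decreasing o′)) (proj₂ (decreasing o′))
      k′-misplaced : ¬ InBox123 xs n π i j k k′
      k′-misplaced (box (here refl) _ (gap π-j<π-k′ _)) = <-asym π-k′<π-i (<-trans π-i<π-j π-j<π-k′)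
      k′-misplaced (box (there (here refl)) _ (gap π-i<π-k′ _)) = <-asym π-k′<π-i π-i<π-k′
      k′-misplaced (box (there (there (here refl))) _ (gap π-k<π-k′ _)) = <-asym π-k′<π-i (<-trans π-i<π-k π-k<π-k′)
      k′-misplaced (box (there (there (there ()))) _ _)

  endsShared : EndsShared (gridMinus xs)
  endsShared {n} {π} {i} {j} {k} {i′} {j′} {k′} P asc asc′ o o′
    with first≡1 asc (occurs-locator xs P asc o) _
       | first≡1 asc′ (occurs-locator xs P asc′ o′) _
  ... | refl | refl = refl , same-last o o′
    where
    same-last : Occurs (gridMinus xs) n π 1 j k → Occurs (gridMinus xs) n π 1 j′ k′ → k ≡ k′
    same-last (inj₁ o₁) (inj₁ o₁′) = ≮∧≯⇒≡ (no-later-123 P asc asc′ o₁ o₁′) (no-later-123 P asc′ asc o₁′ o₁)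
    same-last (inj₂ o₂) (inj₂ o₂′) = ≮∧≯⇒≡ (no-later-321 P asc asc′ o₂ o₂′) (no-later-321 P asc′ asc o₂′ o₂)
    same-last (inj₁ o₁) (inj₂ o₂′) = ⊥-elim (not-both P asc asc′ o₁ o₂′)
    same-last (inj₂ o₂) (inj₁ o₁′) = ⊥-elim (not-both P asc′ asc o₁′ o₂)

module Case18 where

  xs : List (ℕ × ℕ)
  xs = (0 , 0) ∷ (1 , 2) ∷ (2 , 1) ∷ []

  Occ123 Occ321 : ℕ → List ℕ → ℕ → ℕ → ℕ → Set
  Occ123 = Occ (mesh123 (gridMinus xs))
  Occ321 = Occ (mesh321 (gridMinus xs))

  module _ {n : ℕ} {π : List ℕ} {k : ℕ} (P : IsPerm n π) where

    no-earlier-123 : ∀ {i j i′ j′} → Ascending n i j k → Ascending n i′ j′ k →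
      Occ123 n π i j k → Occ123 n π i′ j′ k → ¬ i < i′
    no-earlier-123 {i} {j} {i′} {j′} asc asc′ o o′ i<i′ with i′ ≟ j
    ... | yes refl =
      j′-misplaced (locate123 xs P asc o (j∈ asc′) (>⇒≢ i<j′) (>⇒≢ (i<j asc′)) (<⇒≢ (j<k asc′)))
      where
      i<j′ = <-trans i<i′ (i<j asc′)
      j′-misplaced : ¬ InBox123 xs n π i i′ k j′
      j′-misplaced (box (here refl) (gap _ j′<i) _) = <-asym j′<i i<j′
      j′-misplaced (box (there (here refl)) (gap _ j′<i′) _) = <-asym j′<i′ (i<j asc′)
      j′-misplaced (box (there (there (here refl))) _ (gap _ π-j′<π-i′)) = <-asym π-j′<π-i′ (proj₁ (increasing o′))
      j′-misplaced (box (there (there (there ()))) _ _)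
    ... | no i′≢j = i′-misplaced (locate123 xs P asc o (i∈ asc′) (>⇒≢ i<i′) i′≢j (<⇒≢ (i<k asc′)))
      where
      π-i′<π-j′ = proj₁ (increasing o′)
      j-right-of-i′ : i′ < j → val π j < val π i′ → ⊥
      j-right-of-i′ i′<j π-j<π-i′ with j ≟ j′
      ... | yes refl = <-asym π-j<π-i′ π-i′<π-j′
      ... | no j≢j′ with locate123 xs P asc′ o′ (j∈ asc) (>⇒≢ i′<j) j≢j′ (<⇒≢ (j<k asc))
      ...   | box (here refl) (gap _ j<i′) _ = <-asym j<i′ i′<j
      ...   | box (there (here refl)) _ (gap π-j′<π-j _) = <-asym π-j<π-i′ (<-trans π-i′<π-j′ π-j′<π-j)
      ...   | box (there (there (here refl))) _ (gap π-i′<π-j _) = <-asym π-j<π-i′ π-i′<π-j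
      ...   | box (there (there (there ()))) _ _
      j-left-of-i′ : j < i′ → val π i′ < val π j → ⊥
      j-left-of-i′ j<i′ π-i′<π-j
        with locate123 xs P asc′ o′ (j∈ asc) (<⇒≢ j<i′) (<⇒≢ (<-trans j<i′ (i<j asc′))) (<⇒≢ (j<k asc))
      ... | box (here refl) _ (gap _ π-j<π-i′) = <-asym π-j<π-i′ π-i′<π-j
      ... | box (there (here refl)) (gap i′<j _) _ = <-asym i′<j j<i′
      ... | box (there (there (here refl))) (gap j′<j _) _ = <-asym j′<j (<-trans j<i′ (i<j asc′))
      ... | box (there (there (there ()))) _ _
      i′-misplaced : ¬ InBox123 xs n π i j k i′
      i′-misplaced (box (here refl) (gap _ i′<i) _) = <-asym i′<i i<i′
      i′-misplaced (box (there (here refl)) (gap _ i′<j) (gap π-j<π-i′ _)) = j-right-of-i′ i′<j π-j<π-i′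
      i′-misplaced (box (there (there (here refl))) (gap j<i′ _) (gap _ π-i′<π-j)) = j-left-of-i′ j<i′ π-i′<π-j
      i′-misplaced (box (there (there (there ()))) _ _)

    no-earlier-321 : ∀ {i j i′ j′} → Ascending n i j k → Ascending n i′ j′ k →
      Occ321 n π i j k → Occ321 n π i′ j′ k → ¬ i < i′
    no-earlier-321 {i} {j} {i′} {j′} asc asc′ o o′ i<i′
      with locate321 xs P asc′ o′ (i∈ asc) (<⇒≢ i<i′) (<⇒≢ (<-trans i<i′ (i<j asc′))) (<⇒≢ (i<k asc))
    ... | box (here refl) _ (gap _ π-i<π-k) = <-asym π-i<π-k (<-trans (proj₁ (decreasing o)) (proj₂ (decreasing o)))
    ... | box (there (here refl)) (gap i′<i _) _ = <-asym i′<i i<i′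
    ... | box (there (there (here refl))) (gap j′<i _) _ = <-asym j′<i (<-trans i<i′ (i<j asc′))
    ... | box (there (there (there ()))) _ _

    not-both : ∀ {i j i′ j′} → Ascending n i j k → Ascending n i′ j′ k → Occ123 n π i j k → Occ321 n π i′ j′ k → ⊥
    not-both {i} {j} {i′} {j′} asc asc′ o o′ =
      i′-misplaced (locate123 xs P asc o (i∈ asc′) (λ { refl → <-asym π-k<π-i′ π-i<π-k })
                                                   (λ { refl → <-asym π-k<π-i′ π-j<π-k }) (<⇒≢ (i<k asc′)))
      where
      π-j<π-k = proj₂ (increasing o)
      π-i<π-k = <-trans (proj₁ (increasing o)) π-j<π-k
      π-k<π-i′ = <-trans (proj₁ (decreasing o′)) (proj₂ (decreasing o′))
      i′-misplaced : ¬ InBox123 xs n π i j k i′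
      i′-misplaced (box (here refl) _ (gap _ π-i′<π-i)) = <-asym π-k<π-i′ (<-trans π-i′<π-i π-i<π-k)
      i′-misplaced (box (there (here refl)) _ (gap _ π-i′<π-k)) = <-asym π-k<π-i′ π-i′<π-k
      i′-misplaced (box (there (there (here refl))) _ (gap _ π-i′<π-j)) = <-asym π-k<π-i′ (<-trans π-i′<π-j π-j<π-k)
      i′-misplaced (box (there (there (there ()))) _ _)

  endsShared : EndsShared (gridMinus xs)
  endsShared {n} {π} {i} {j} {k} {i′} {j′} {k′} P asc asc′ o o′
    with last≡n asc (occurs-locator xs P asc o) _
       | last≡n asc′ (occurs-locator xs P asc′ o′) _
  ... | refl | refl = same-first o o′ , refl
    where
    same-first : Occurs (gridMinus xs) n π i j n → Occurs (gridMinus xs) n π i′ j′ n → i ≡ i′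
    same-first (inj₁ o₁) (inj₁ o₁′) = ≮∧≯⇒≡ (no-earlier-123 P asc asc′ o₁ o₁′) (no-earlier-123 P asc′ asc o₁′ o₁)
    same-first (inj₂ o₂) (inj₂ o₂′) = ≮∧≯⇒≡ (no-earlier-321 P asc asc′ o₂ o₂′) (no-earlier-321 P asc′ asc o₂′ o₂)
    same-first (inj₁ o₁) (inj₂ o₂′) = ⊥-elim (not-both P asc asc′ o₁ o₂′)
    same-first (inj₂ o₂) (inj₁ o₁′) = ⊥-elim (not-both P asc′ asc o₁′ o₂)

endsShared : (c : Case) → EndsShared (shading c)
endsShared S9  = endsShared-S9
endsShared S10 = endsShared-S10
endsShared S11 = outerColumnsFree⇒endsShared ((2 , 2) ∷ []) _ _
endsShared S12 = outerColumnsFree⇒endsShared ((1 , 1) ∷ []) _ _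
endsShared S13 = outerColumnsFree⇒endsShared ((1 , 2) ∷ (2 , 1) ∷ []) _ _
endsShared S14 = outerColumnsFree⇒endsShared ((1 , 1) ∷ (2 , 2) ∷ []) _ _
endsShared S15 = outerColumnsFree⇒endsShared ((1 , 2) ∷ (2 , 1) ∷ (2 , 2) ∷ []) _ _
endsShared S16 = outerColumnsFree⇒endsShared ((1 , 1) ∷ (1 , 2) ∷ (2 , 1) ∷ []) _ _
endsShared S17 = Case17.endsShared
endsShared S18 = Case18.endsShared

mainTheorem2 : (c : Case) → JointlyEquidistributed (p123 c) (p321 c)
mainTheorem2 c = endsShared⇒jointlyEquidistributed (endsShared c)
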